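{- Let $\{V_n\}_{n\ge0}$ be a generalized Tetranacci sequence (see context). Then, as formal power series, \[ \sum_{n=0}^\infty V_{2n}x^n=\frac{V_{0}+(-3V_{0}+V_{2})x+(-2V_{0}+V_{1}-2V_{2}+V_{3})x^{2}+(-2V_{2}+V_{3})x^{3}}{x^{4}+x^{3}-3x^{2}-3x+1} \] and \[ \sum_{n=0}^\infty V_{2n+1}x^n=\frac{V_{1}+(-3V_{1}+V_{3})x+(V_{0}-V_{1}+2V_{2}-V_{3})x^{2}+(V_{0}+V_{1}+V_{2}-V_{3})x^{3}}{x^{4}+x^{3}-3x^{2}-3x+1}. \]
   Context: Let $c_0,c_1,c_2,c_3$ be numbers, not all zero. The generalized Tetranacci sequence $\{V_n\}$ is defined by $V_0=c_0,V_1=c_1,V_2=c_2,V_3=c_3$ and $V_n=V_{n-1}+V_{n-2}+V_{n-3}+V_{n-4}$ for $n\ge4$. -}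

module Defs where

open import Level using (Level)
open import Algebra.Bundles using (CommutativeRing)
open import Data.Nat using (ℕ; zero; suc; _∸_)
open import Data.List using (List; []; _∷_)

module FPS {c ℓ : Level} (R : CommutativeRing c ℓ) where
  open CommutativeRing R hiding (zero)

  Series : Set c
  Series = ℕ → Carrier

  _≋_ : Series → Series → Set ℓ
  f ≋ g = ∀ n → f n ≈ g n

  sumUpTo : (ℕ → Carrier) → ℕ → Carrier
  sumUpTo h zero    = h zero
  sumUpTo h (suc n) = sumUpTo h n + h (suc n)

  _⊛_ : Series → Series → Series
  (f ⊛ g) n = sumUpTo (λ i → f i * g (n ∸ i)) n

  cubic : Carrier → Carrier → Carrier → Carrier → Series
  cubic a0 a1 a2 a3 zero                      = a0
  cubic a0 a1 a2 a3 (suc zero)                = a1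
  cubic a0 a1 a2 a3 (suc (suc zero))          = a2
  cubic a0 a1 a2 a3 (suc (suc (suc zero)))    = a3
  cubic a0 a1 a2 a3 (suc (suc (suc (suc _)))) = 0#

  quartic : Carrier → Carrier → Carrier → Carrier → Carrier → Series
  quartic a0 a1 a2 a3 a4 (suc (suc (suc (suc zero)))) = a4
  quartic a0 a1 a2 a3 a4 (suc (suc (suc (suc (suc _))))) = 0#
  quartic a0 a1 a2 a3 a4 n = cubic a0 a1 a2 a3 n

  -- Multiplicative inverse of a series g with constant term 1 (the
  -- unique b with g ⊛ b ≋ 1): b 0 = 1, b (n+1) = - Σ_{i=1}^{n+1} g i * b (n+1-i).
  -- invRev g n is the list [b n, ..., b 0].
  private
    dot : Series → List Carrier → ℕ → Carrier
    dot g []       k = 0#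
    dot g (b ∷ bs) k = g k * b + dot g bs (suc k)

  invRev : Series → ℕ → List Carrier
  invRev g zero    = 1# ∷ []
  invRev g (suc n) = (- dot g (invRev g n) 1) ∷ invRev g n

  inv : Series → Series
  inv g n with invRev g n
  ... | []    = 0#
  ... | b ∷ _ = b

  -- f / g for g with constant term 1
  _⊘_ : Series → Series → Series
  f ⊘ g = f ⊛ inv g

  tetra : Carrier → Carrier → Carrier → Carrier → ℕ → Carrier
  tetra c0 c1 c2 c3 zero                   = c0
  tetra c0 c1 c2 c3 (suc zero)             = c1
  tetra c0 c1 c2 c3 (suc (suc zero))       = c2
  tetra c0 c1 c2 c3 (suc (suc (suc zero))) = c3
  tetra c0 c1 c2 c3 (suc (suc (suc (suc n)))) =
    tetra c0 c1 c2 c3 (suc (suc (suc n))) + tetra c0 c1 c2 c3 (suc (suc n))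
    + tetra c0 c1 c2 c3 (suc n) + tetra c0 c1 c2 c3 n

-- Let D = 1 - 3x - 3x² + x³ + x⁴. Since (y⁴ - y³ - y² - y - 1)(y⁴ + y³ - y² + y - 1) = y⁸ D(y⁻²),
-- both bisections W of a Tetranacci sequence satisfy the order-4 recurrence read off from D,
-- i.e. D·W is a polynomial of degree < 4, namely the numerator N of the statement. The series
-- N ⊘ D satisfies the same recurrence, being a combination of four shifts of the coefficients
-- of 1/D, and it has the same first four coefficients as W because N is D·W truncated. A
-- solution of the recurrence is determined by its first four terms.
module Submission where

open import Defs
open import Level using (Level)
open import Algebra.Bundles using (CommutativeRing)
open import Data.Nat using (ℕ; _*_; suc)
open import Data.Product using (_×_; _,_)
open import Relation.Nullary using (¬_)

open import Data.Nat as ℕ using (zero; z<s; s<s)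
import Data.Nat.Properties as ℕₚ
open import Data.Nat.Tactic.RingSolver using (solve-∀)
open import Data.Integer as ℤ using (ℤ; +_; -[1+_]; _⊖_; ∣_∣; sign)
import Data.Integer.Properties as ℤₚ
open import Data.Sign as Sign using (Sign)
open import Data.List using (List; []; _∷_)
open import Data.Maybe using (Maybe; just; nothing)
open import Relation.Nullary using (yes; no)
import Relation.Binary.PropositionalEquality as ≡
open import Algebra.Solver.Ring.AlmostCommutativeRing
  using (_-Raw-AlmostCommutative⟶_; fromCommutativeRing)

j+2*[k+n]≡2*k+[j+2*n] : ∀ j k n → j ℕ.+ 2 * (k ℕ.+ n) ≡.≡ 2 * k ℕ.+ (j ℕ.+ 2 * n)
j+2*[k+n]≡2*k+[j+2*n] = solve-∀

module IntegerCoefficients {c ℓ : Level} (R : CommutativeRing c ℓ) where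
  open CommutativeRing R renaming (_*_ to _·_)
  open import Algebra.Properties.Ring ring using (-‿distribˡ-*; -‿distribʳ-*)
  open import Algebra.Properties.Group +-group using (ε⁻¹≈ε; ⁻¹-involutive)
  open import Algebra.Properties.AbelianGroup +-abelianGroup using (⁻¹-∙-comm)
  open import Algebra.Properties.CommutativeSemigroup +-commutativeSemigroup using (interchange)
  open import Algebra.Properties.Semiring.Mult.TCOptimised semiring
    using (1+×; ×-homo-+; ×1-homo-*) renaming (_×_ to _×′_)
  open import Relation.Binary.Reasoning.Setoid setoid

  -- The optimised multiple makes ι (+ 1), ι (+ 2), ι (+ 3) reduce to 1#, 1# + 1#, (1# + 1#) + 1#,
  -- so solver constants match the numerals of the statement definitionally.
  ι : ℤ → Carrier
  ι (+ n)    = n ×′ 1#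
  ι -[1+ n ] = - (suc n ×′ 1#)

  signed : Sign → Carrier → Carrier
  signed Sign.+ x = x
  signed Sign.- x = - x

  signed-cong : ∀ s {x y} → x ≈ y → signed s x ≈ signed s y
  signed-cong Sign.+ x≈y = x≈y
  signed-cong Sign.- x≈y = -‿cong x≈y

  signed-* : ∀ s t x y → signed (s Sign.* t) (x · y) ≈ signed s x · signed t y
  signed-* Sign.+ Sign.+ x y = refl
  signed-* Sign.+ Sign.- x y = -‿distribʳ-* x y
  signed-* Sign.- Sign.+ x y = -‿distribˡ-* x y
  signed-* Sign.- Sign.- x y = begin
    x · y         ≈⟨ ⁻¹-involutive (x · y) ⟨
    - - (x · y)   ≈⟨ -‿cong (-‿distribˡ-* x y) ⟩
    - (- x · y)   ≈⟨ -‿distribʳ-* (- x) y ⟩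
    - x · - y     ∎

  ι-◃ : ∀ s n → ι (s ℤ.◃ n) ≈ signed s (n ×′ 1#)
  ι-◃ Sign.+ zero    = refl
  ι-◃ Sign.- zero    = sym ε⁻¹≈ε
  ι-◃ Sign.+ (suc n) = refl
  ι-◃ Sign.- (suc n) = refl

  ι-signAbs : ∀ i → ι i ≈ signed (sign i) (∣ i ∣ ×′ 1#)
  ι-signAbs (+ n)    = refl
  ι-signAbs -[1+ n ] = refl

  ι-homo-* : ∀ i j → ι (i ℤ.* j) ≈ ι i · ι j
  ι-homo-* i j = begin
    ι (i ℤ.* j)                        ≈⟨ ι-◃ (s Sign.* t) (∣ i ∣ ℕ.* ∣ j ∣) ⟩
    signed (s Sign.* t) ((∣ i ∣ ℕ.* ∣ j ∣) ×′ 1#)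
                                       ≈⟨ signed-cong (s Sign.* t) (×1-homo-* ∣ i ∣ ∣ j ∣) ⟩
    signed (s Sign.* t) (∣ i ∣ ×′ 1# · ∣ j ∣ ×′ 1#)
                                       ≈⟨ signed-* s t _ _ ⟩
    signed s (∣ i ∣ ×′ 1#) · signed t (∣ j ∣ ×′ 1#)
                                       ≈⟨ *-cong (ι-signAbs i) (ι-signAbs j) ⟨
    ι i · ι j                          ∎
    where s = sign i; t = sign j

  ι-homo-⊖ : ∀ m n → ι (m ⊖ n) ≈ m ×′ 1# - n ×′ 1#
  ι-homo-⊖ zero    zero    = sym (trans (+-congˡ ε⁻¹≈ε) (+-identityʳ 0#))
  ι-homo-⊖ zero    (suc n) = sym (+-identityˡ _)
  ι-homo-⊖ (suc m) zero    = sym (trans (+-congˡ ε⁻¹≈ε) (+-identityʳ _))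
  ι-homo-⊖ (suc m) (suc n) = begin
    ι (suc m ⊖ suc n)            ≡⟨ ≡.cong ι (ℤₚ.[1+m]⊖[1+n]≡m⊖n m n) ⟩
    ι (m ⊖ n)                    ≈⟨ ι-homo-⊖ m n ⟩
    x - y                        ≈⟨ +-identityˡ (x - y) ⟨
    0# + (x - y)                 ≈⟨ +-congʳ (-‿inverseʳ 1#) ⟨
    (1# - 1#) + (x - y)          ≈⟨ interchange 1# (- 1#) x (- y) ⟩
    (1# + x) + (- 1# - y)        ≈⟨ +-congˡ (⁻¹-∙-comm 1# y) ⟩
    (1# + x) - (1# + y)          ≈⟨ +-cong (1+× m 1#) (-‿cong (1+× n 1#)) ⟨
    suc m ×′ 1# - suc n ×′ 1#    ∎
    where x = m ×′ 1#; y = n ×′ 1#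

  ι-homo-+ : ∀ i j → ι (i ℤ.+ j) ≈ ι i + ι j
  ι-homo-+ (+ m)    (+ n)    = ×-homo-+ 1# m n
  ι-homo-+ (+ m)    -[1+ n ] = ι-homo-⊖ m (suc n)
  ι-homo-+ -[1+ m ] (+ n)    = trans (ι-homo-⊖ n (suc m)) (+-comm _ _)
  ι-homo-+ -[1+ m ] -[1+ n ] = begin
    - (suc (suc (m ℕ.+ n)) ×′ 1#)      ≡⟨ ≡.cong (λ k → - (suc k ×′ 1#)) (ℕₚ.+-suc m n) ⟨
    - ((suc m ℕ.+ suc n) ×′ 1#)        ≈⟨ -‿cong (×-homo-+ 1# (suc m) (suc n)) ⟩
    - (suc m ×′ 1# + suc n ×′ 1#)      ≈⟨ ⁻¹-∙-comm _ _ ⟨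
    - (suc m ×′ 1#) + - (suc n ×′ 1#)  ∎

  ι-homo-neg : ∀ i → ι (ℤ.- i) ≈ - ι i
  ι-homo-neg (+ zero)  = sym ε⁻¹≈ε
  ι-homo-neg (+ suc n) = refl
  ι-homo-neg -[1+ n ]  = sym (⁻¹-involutive _)

  ι-homomorphism : ℤ.+-*-rawRing -Raw-AlmostCommutative⟶ fromCommutativeRing R
  ι-homomorphism = record
    { ⟦_⟧ = ι ; +-homo = ι-homo-+ ; *-homo = ι-homo-* ; -‿homo = ι-homo-neg
    ; 0-homo = refl ; 1-homo = refl }

  ≟-weak : ∀ i j → Maybe (ι i ≈ ι j)
  ≟-weak i j with i ℤ.≟ j
  ... | yes ≡.refl = just refl
  ... | no _       = nothing

  open import Algebra.Solver.Ring ℤ.+-*-rawRing (fromCommutativeRing R) ι-homomorphism ≟-weak public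

module PowerSeries {c ℓ : Level} (R : CommutativeRing c ℓ) where
  open CommutativeRing R hiding (zero) renaming (_*_ to _·_)
  open FPS R
  open IntegerCoefficients R using (Polynomial; solve; _:=_; con; _:+_; _:*_; :-_; _:-_)
  open import Relation.Binary.Reasoning.Setoid setoid

  𝟎 𝟏 𝟐 𝟑 : ∀ {m} → Polynomial m
  𝟎 = con (+ 0)
  𝟏 = con (+ 1)
  𝟐 = con (+ 2)
  𝟑 = con (+ 3)

  sumUpTo-cong : ∀ {h h′} → h ≋ h′ → ∀ n → sumUpTo h n ≈ sumUpTo h′ n
  sumUpTo-cong h≋h′ zero    = h≋h′ zero
  sumUpTo-cong h≋h′ (suc n) = +-cong (sumUpTo-cong h≋h′ n) (h≋h′ (suc n))

  sumUpTo-vanishing : ∀ {h} k → (∀ j → h (suc (k ℕ.+ j)) ≈ 0#) →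
                      ∀ m → sumUpTo h (k ℕ.+ m) ≈ sumUpTo h k
  sumUpTo-vanishing k h≈0 zero    rewrite ℕₚ.+-identityʳ k = refl
  sumUpTo-vanishing k h≈0 (suc m) rewrite ℕₚ.+-suc k m =
    trans (+-cong (sumUpTo-vanishing k h≈0 m) (h≈0 m)) (+-identityʳ _)

  ⊛-congˡ : ∀ {f f′} h → f ≋ f′ → (f ⊛ h) ≋ (f′ ⊛ h)
  ⊛-congˡ h f≋f′ n = sumUpTo-cong (λ i → *-congʳ (f≋f′ i)) n

  cubic-cong : ∀ {a0 a1 a2 a3 b0 b1 b2 b3} → a0 ≈ b0 → a1 ≈ b1 → a2 ≈ b2 → a3 ≈ b3 →
               cubic a0 a1 a2 a3 ≋ cubic b0 b1 b2 b3
  cubic-cong e0 e1 e2 e3 0                         = e0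
  cubic-cong e0 e1 e2 e3 1                         = e1
  cubic-cong e0 e1 e2 e3 2                         = e2
  cubic-cong e0 e1 e2 e3 3                         = e3
  cubic-cong e0 e1 e2 e3 (suc (suc (suc (suc _)))) = refl

  truncate₄ : Series → Series
  truncate₄ f = cubic (f 0) (f 1) (f 2) (f 3)

  delay₃ : Series → Series
  delay₃ h 0                   = 0#
  delay₃ h 1                   = 0#
  delay₃ h 2                   = 0#
  delay₃ h (suc (suc (suc n))) = h n

  cubic-⊛ : ∀ a0 a1 a2 a3 h n → (cubic a0 a1 a2 a3 ⊛ h) n ≈
            a0 · delay₃ h (3 ℕ.+ n) + a1 · delay₃ h (2 ℕ.+ n) + a2 · delay₃ h (1 ℕ.+ n) + a3 · delay₃ h n
  cubic-⊛ a0 a1 a2 a3 h 0 = solve 5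
    (λ a0 a1 a2 a3 x → a0 :* x := a0 :* x :+ a1 :* 𝟎 :+ a2 :* 𝟎 :+ a3 :* 𝟎)
    refl a0 a1 a2 a3 (h 0)
  cubic-⊛ a0 a1 a2 a3 h 1 = solve 6
    (λ a0 a1 a2 a3 x y → a0 :* y :+ a1 :* x := a0 :* y :+ a1 :* x :+ a2 :* 𝟎 :+ a3 :* 𝟎)
    refl a0 a1 a2 a3 (h 0) (h 1)
  cubic-⊛ a0 a1 a2 a3 h 2 = solve 7
    (λ a0 a1 a2 a3 x y z → a0 :* z :+ a1 :* y :+ a2 :* x := a0 :* z :+ a1 :* y :+ a2 :* x :+ a3 :* 𝟎)
    refl a0 a1 a2 a3 (h 0) (h 1) (h 2)
  cubic-⊛ a0 a1 a2 a3 h (suc (suc (suc m))) = sumUpTo-vanishing 3 (λ _ → zeroˡ _) m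

  Degree≤4 : Series → Set ℓ
  Degree≤4 g = ∀ j → g (5 ℕ.+ j) ≈ 0#

  recurrenceStep : Series → Series → ℕ → Carrier
  recurrenceStep g S n = - (g 1 · S (3 ℕ.+ n) + (g 2 · S (2 ℕ.+ n) + (g 3 · S (1 ℕ.+ n) + g 4 · S n)))

  -- When g 0 = 1# and Degree≤4 g, Recurrent g S says that g ⊛ S has no coefficients of degree ≥ 4.
  record Recurrent (g S : Series) : Set ℓ where
    constructor recurrent
    field step : ∀ n → S (4 ℕ.+ n) ≈ recurrenceStep g S n
  open Recurrent

  recurrenceStep-cong : ∀ g S T n → S (3 ℕ.+ n) ≈ T (3 ℕ.+ n) → S (2 ℕ.+ n) ≈ T (2 ℕ.+ n) →
                        S (1 ℕ.+ n) ≈ T (1 ℕ.+ n) → S n ≈ T n →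
                        recurrenceStep g S n ≈ recurrenceStep g T n
  recurrenceStep-cong g S T n e3 e2 e1 e0 =
    -‿cong (+-cong (*-congˡ e3) (+-cong (*-congˡ e2) (+-cong (*-congˡ e1) (*-congˡ e0))))

  recurrent-unique : ∀ {g S T} → Recurrent g S → Recurrent g T →
                     (∀ k → k ℕ.< 4 → S k ≈ T k) → S ≋ T
  recurrent-unique {g} {S} {T} recS recT initial = agree
    where
    agree : S ≋ T
    agree 0 = initial 0 z<s
    agree 1 = initial 1 (s<s z<s)
    agree 2 = initial 2 (s<s (s<s z<s))
    agree 3 = initial 3 (s<s (s<s (s<s z<s)))
    agree (suc (suc (suc (suc n)))) = begin
      S (4 ℕ.+ n)            ≈⟨ step recS n ⟩
      recurrenceStep g S n   ≈⟨ recurrenceStep-cong g S T n (agree (suc (suc (suc n))))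
                                  (agree (suc (suc n))) (agree (suc n)) (agree n) ⟩
      recurrenceStep g T n   ≈⟨ step recT n ⟨
      T (4 ℕ.+ n)            ∎

  recurrent-resp : ∀ {g S T} → S ≋ T → Recurrent g S → Recurrent g T
  recurrent-resp {g} {S} {T} S≋T recS = recurrent λ n → begin
    T (4 ℕ.+ n)            ≈⟨ S≋T (4 ℕ.+ n) ⟨
    S (4 ℕ.+ n)            ≈⟨ step recS n ⟩
    recurrenceStep g S n   ≈⟨ recurrenceStep-cong g S T n (S≋T (3 ℕ.+ n)) (S≋T (2 ℕ.+ n))
                                (S≋T (1 ℕ.+ n)) (S≋T n) ⟩
    recurrenceStep g T n   ∎

  recurrent-suc : ∀ {g S} → Recurrent g S → Recurrent g (λ n → S (suc n))
  recurrent-suc recS = recurrent λ n → step recS (suc n)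

  recurrent-+ : ∀ {g S T} → Recurrent g S → Recurrent g T → Recurrent g (λ n → S n + T n)
  recurrent-+ {g} {S} {T} recS recT = recurrent λ n →
    trans (+-cong (step recS n) (step recT n)) (solve 12
      (λ a b c d x y z w x′ y′ z′ w′ →
         :- (a :* x :+ (b :* y :+ (c :* z :+ d :* w)))
           :+ :- (a :* x′ :+ (b :* y′ :+ (c :* z′ :+ d :* w′)))
         := :- (a :* (x :+ x′) :+ (b :* (y :+ y′) :+ (c :* (z :+ z′) :+ d :* (w :+ w′)))))
      refl (g 1) (g 2) (g 3) (g 4) (S (3 ℕ.+ n)) (S (2 ℕ.+ n)) (S (1 ℕ.+ n)) (S n)
           (T (3 ℕ.+ n)) (T (2 ℕ.+ n)) (T (1 ℕ.+ n)) (T n))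

  recurrent-scale : ∀ {g S} a → Recurrent g S → Recurrent g (λ n → a · S n)
  recurrent-scale {g} {S} a recS = recurrent λ n →
    trans (*-congˡ (step recS n)) (solve 9
      (λ a′ a b c d x y z w →
         a′ :* :- (a :* x :+ (b :* y :+ (c :* z :+ d :* w)))
         := :- (a :* (a′ :* x) :+ (b :* (a′ :* y) :+ (c :* (a′ :* z) :+ d :* (a′ :* w)))))
      refl a (g 1) (g 2) (g 3) (g 4) (S (3 ℕ.+ n)) (S (2 ℕ.+ n)) (S (1 ℕ.+ n)) (S n))

  recurrent-cubicCombination : ∀ {g S} a0 a1 a2 a3 → Recurrent g S →
    Recurrent g (λ n → a0 · S (3 ℕ.+ n) + a1 · S (2 ℕ.+ n) + a2 · S (1 ℕ.+ n) + a3 · S n)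
  recurrent-cubicCombination a0 a1 a2 a3 recS =
    recurrent-+ (recurrent-+ (recurrent-+
      (recurrent-scale a0 (recurrent-suc (recurrent-suc (recurrent-suc recS))))
      (recurrent-scale a1 (recurrent-suc (recurrent-suc recS))))
      (recurrent-scale a2 (recurrent-suc recS)))
      (recurrent-scale a3 recS)

  -- FPS.dot is private: dotOf is recovered from the unfolding of inv by unification, which the
  -- with-generalisation of the list and the offset turns into a pattern problem.
  mutual
    dotOf : Series → List Carrier → ℕ → Carrier
    dotOf = λ g L k → _

    inv-suc : ∀ g n → inv g (suc n) ≡.≡ - dotOf g (invRev g n) 1
    inv-suc g n with invRev g n | 1
    ... | L | k = ≡.refl

  dotOf-vanishing : ∀ {g} → Degree≤4 g → ∀ L j → dotOf g L (5 ℕ.+ j) ≈ 0#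
  dotOf-vanishing g≈0 []      j = refl
  dotOf-vanishing g≈0 (x ∷ L) j =
    trans (+-cong (trans (*-congʳ (g≈0 j)) (zeroˡ x)) (dotOf-vanishing g≈0 L (suc j)))
          (+-identityʳ 0#)

  dotOf-invRev-4 : ∀ {g} → Degree≤4 g → ∀ n → dotOf g (invRev g n) 4 ≈ g 4 · inv g n
  dotOf-invRev-4     g≈0 zero    = +-identityʳ _
  dotOf-invRev-4 {g} g≈0 (suc n) =
    trans (+-congˡ (dotOf-vanishing g≈0 (invRev g n) 0)) (+-identityʳ _)

  inv-recurrent : ∀ {g} → Degree≤4 g → Recurrent g (inv g)
  inv-recurrent {g} g≈0 = recurrent λ n → begin
    inv g (4 ℕ.+ n)                    ≡⟨ inv-suc g (3 ℕ.+ n) ⟩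
    - dotOf g (invRev g (3 ℕ.+ n)) 1   ≈⟨ -‿cong (+-congˡ (+-congˡ (+-congˡ (dotOf-invRev-4 g≈0 n)))) ⟩
    recurrenceStep g (inv g) n         ∎

  delay₃-inv-recurrent : ∀ {g} → Degree≤4 g → Recurrent g (delay₃ (inv g))
  delay₃-inv-recurrent {g} g≈0 = recurrent delayed
    where
    zero-tail : g 3 · 0# + g 4 · 0# ≈ 0#
    zero-tail = trans (+-cong (zeroʳ (g 3)) (zeroʳ (g 4))) (+-identityʳ 0#)

    delayed : ∀ n → delay₃ (inv g) (4 ℕ.+ n) ≈ recurrenceStep g (delay₃ (inv g)) n
    delayed 0 = -‿cong (+-congˡ (sym (trans (+-cong (zeroʳ (g 2)) zero-tail) (+-identityʳ 0#))))
    delayed 1 = -‿cong (+-congˡ (+-congˡ (sym zero-tail)))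
    delayed 2 = -‿cong (+-congˡ (+-congˡ (+-congˡ (sym (zeroʳ (g 4))))))
    delayed (suc (suc (suc m))) = step (inv-recurrent g≈0) m

  cubic⊘-recurrent : ∀ {g} a0 a1 a2 a3 → Degree≤4 g → Recurrent g (cubic a0 a1 a2 a3 ⊘ g)
  cubic⊘-recurrent {g} a0 a1 a2 a3 g≈0 =
    recurrent-resp (λ n → sym (cubic-⊛ a0 a1 a2 a3 (inv g) n))
                   (recurrent-cubicCombination a0 a1 a2 a3 (delay₃-inv-recurrent g≈0))

  quartic⊘-initial : ∀ a1 a2 a3 a4 W k → k ℕ.< 4 →
    (truncate₄ (quartic 1# a1 a2 a3 a4 ⊛ W) ⊘ quartic 1# a1 a2 a3 a4) k ≈ W k
  quartic⊘-initial a1 a2 a3 a4 W 0 z<s = solve 1 (λ w0 → (𝟏 :* w0) :* 𝟏 := w0) refl (W 0)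
  quartic⊘-initial a1 a2 a3 a4 W 1 (s<s z<s) = solve 3
    (λ a1 w0 w1 →
       let b1 = :- (a1 :* 𝟏 :+ 𝟎)
       in (𝟏 :* w0) :* b1 :+ (𝟏 :* w1 :+ a1 :* w0) :* 𝟏 := w1)
    refl a1 (W 0) (W 1)
  quartic⊘-initial a1 a2 a3 a4 W 2 (s<s (s<s z<s)) = solve 5
    (λ a1 a2 w0 w1 w2 →
       let b1 = :- (a1 :* 𝟏 :+ 𝟎)
           b2 = :- (a1 :* b1 :+ (a2 :* 𝟏 :+ 𝟎))
       in (𝟏 :* w0) :* b2 :+ (𝟏 :* w1 :+ a1 :* w0) :* b1
          :+ (𝟏 :* w2 :+ a1 :* w1 :+ a2 :* w0) :* 𝟏 := w2)
    refl a1 a2 (W 0) (W 1) (W 2)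
  quartic⊘-initial a1 a2 a3 a4 W 3 (s<s (s<s (s<s z<s))) = solve 7
    (λ a1 a2 a3 w0 w1 w2 w3 →
       let b1 = :- (a1 :* 𝟏 :+ 𝟎)
           b2 = :- (a1 :* b1 :+ (a2 :* 𝟏 :+ 𝟎))
           b3 = :- (a1 :* b2 :+ (a2 :* b1 :+ (a3 :* 𝟏 :+ 𝟎)))
       in (𝟏 :* w0) :* b3 :+ (𝟏 :* w1 :+ a1 :* w0) :* b2
          :+ (𝟏 :* w2 :+ a1 :* w1 :+ a2 :* w0) :* b1
          :+ (𝟏 :* w3 :+ a1 :* w2 :+ a2 :* w1 :+ a3 :* w0) :* 𝟏 := w3)
    refl a1 a2 a3 (W 0) (W 1) (W 2) (W 3)

  recurrent⇒≋⊘ : ∀ a1 a2 a3 a4 W → Recurrent (quartic 1# a1 a2 a3 a4) W →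
                 W ≋ (truncate₄ (quartic 1# a1 a2 a3 a4 ⊛ W) ⊘ quartic 1# a1 a2 a3 a4)
  recurrent⇒≋⊘ a1 a2 a3 a4 W recW =
    recurrent-unique recW (cubic⊘-recurrent _ _ _ _ (λ _ → refl))
                     (λ k k<4 → sym (quartic⊘-initial a1 a2 a3 a4 W k k<4))

  two three : Carrier
  two   = 1# + 1#
  three = two + 1#

  bisectedDenominator : Series
  bisectedDenominator = quartic 1# (- three) (- three) 1# 1#

  -- Mirrors the recursion of tetra, so that solver expressions built from it denote
  -- the unfoldings of tetra on the nose.
  tetraᴾ : ∀ {m} → Polynomial m → Polynomial m → Polynomial m → Polynomial m → ℕ → Polynomial m
  tetraᴾ x0 x1 x2 x3 0 = x0
  tetraᴾ x0 x1 x2 x3 1 = x1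
  tetraᴾ x0 x1 x2 x3 2 = x2
  tetraᴾ x0 x1 x2 x3 3 = x3
  tetraᴾ x0 x1 x2 x3 (suc (suc (suc (suc n)))) =
    tetraᴾ x0 x1 x2 x3 (suc (suc (suc n))) :+ tetraᴾ x0 x1 x2 x3 (suc (suc n))
    :+ tetraᴾ x0 x1 x2 x3 (suc n) :+ tetraᴾ x0 x1 x2 x3 n

  tetra-everyOther-recurrent : ∀ c0 c1 c2 c3 j →
    Recurrent bisectedDenominator (λ n → tetra c0 c1 c2 c3 (j ℕ.+ 2 * n))
  tetra-everyOther-recurrent c0 c1 c2 c3 j = recurrent λ n →
    octave (j ℕ.+ 2 * n) (j+2*[k+n]≡2*k+[j+2*n] j 4 n) (j+2*[k+n]≡2*k+[j+2*n] j 3 n)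
           (j+2*[k+n]≡2*k+[j+2*n] j 2 n) (j+2*[k+n]≡2*k+[j+2*n] j 1 n)
    where
    V : Series
    V = tetra c0 c1 c2 c3

    octave : ∀ m {a b c d} → a ≡.≡ 8 ℕ.+ m → b ≡.≡ 6 ℕ.+ m → c ≡.≡ 4 ℕ.+ m → d ≡.≡ 2 ℕ.+ m →
             V a ≈ - ((- three) · V b + ((- three) · V c + (1# · V d + 1# · V m)))
    octave m ≡.refl ≡.refl ≡.refl ≡.refl = solve 4
      (λ x0 x1 x2 x3 → let x = tetraᴾ x0 x1 x2 x3 in
         x 8 := :- (:- 𝟑 :* x 6 :+ (:- 𝟑 :* x 4 :+ (𝟏 :* x 2 :+ 𝟏 :* x 0))))
      refl (V m) (V (1 ℕ.+ m)) (V (2 ℕ.+ m)) (V (3 ℕ.+ m))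

  tetra-even-numerator : ∀ c0 c1 c2 c3 → let V = tetra c0 c1 c2 c3 in
    truncate₄ (bisectedDenominator ⊛ (λ n → V (2 * n)))
      ≋ cubic (V 0) (- (three · V 0) + V 2) (- (two · V 0) + V 1 - two · V 2 + V 3)
              (- (two · V 2) + V 3)
  tetra-even-numerator c0 c1 c2 c3 = cubic-cong
    (solve 1 (λ x0 → 𝟏 :* x0 := x0) refl c0)
    (solve 2 (λ x0 x2 → 𝟏 :* x2 :+ :- 𝟑 :* x0 := :- (𝟑 :* x0) :+ x2) refl c0 c2)
    (solve 4 (λ x0 x1 x2 x3 → let x = tetraᴾ x0 x1 x2 x3 in
       𝟏 :* x 4 :+ :- 𝟑 :* x 2 :+ :- 𝟑 :* x 0 := :- (𝟐 :* x0) :+ x1 :- 𝟐 :* x2 :+ x3)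
       refl c0 c1 c2 c3)
    (solve 4 (λ x0 x1 x2 x3 → let x = tetraᴾ x0 x1 x2 x3 in
       𝟏 :* x 6 :+ :- 𝟑 :* x 4 :+ :- 𝟑 :* x 2 :+ 𝟏 :* x 0 := :- (𝟐 :* x2) :+ x3)
       refl c0 c1 c2 c3)

  tetra-odd-numerator : ∀ c0 c1 c2 c3 → let V = tetra c0 c1 c2 c3 in
    truncate₄ (bisectedDenominator ⊛ (λ n → V (suc (2 * n))))
      ≋ cubic (V 1) (- (three · V 1) + V 3) (V 0 - V 1 + two · V 2 - V 3) (V 0 + V 1 + V 2 - V 3)
  tetra-odd-numerator c0 c1 c2 c3 = cubic-cong
    (solve 1 (λ x1 → 𝟏 :* x1 := x1) refl c1)
    (solve 2 (λ x1 x3 → 𝟏 :* x3 :+ :- 𝟑 :* x1 := :- (𝟑 :* x1) :+ x3) refl c1 c3)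
    (solve 4 (λ x0 x1 x2 x3 → let x = tetraᴾ x0 x1 x2 x3 in
       𝟏 :* x 5 :+ :- 𝟑 :* x 3 :+ :- 𝟑 :* x 1 := x0 :- x1 :+ 𝟐 :* x2 :- x3)
       refl c0 c1 c2 c3)
    (solve 4 (λ x0 x1 x2 x3 → let x = tetraᴾ x0 x1 x2 x3 in
       𝟏 :* x 7 :+ :- 𝟑 :* x 5 :+ :- 𝟑 :* x 3 :+ 𝟏 :* x 1 := x0 :+ x1 :+ x2 :- x3)
       refl c0 c1 c2 c3)

  tetra-everyOther-⊘ : ∀ c0 c1 c2 c3 j {N} → let W = λ n → tetra c0 c1 c2 c3 (j ℕ.+ 2 * n) in
    truncate₄ (bisectedDenominator ⊛ W) ≋ N → W ≋ (N ⊘ bisectedDenominator)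
  tetra-everyOther-⊘ c0 c1 c2 c3 j W≈N n =
    trans (recurrent⇒≋⊘ _ _ _ _ _ (tetra-everyOther-recurrent c0 c1 c2 c3 j) n)
          (⊛-congˡ (inv bisectedDenominator) W≈N n)

mainTheorem8 : ∀ {c ℓ : Level} (R : CommutativeRing c ℓ) →
  let open CommutativeRing R renaming (_*_ to _·_)
      open FPS R
  in (c0 c1 c2 c3 : Carrier) →
     ¬ (c0 ≈ 0# × c1 ≈ 0# × c2 ≈ 0# × c3 ≈ 0#) →
     let V = tetra c0 c1 c2 c3
         two = 1# + 1#
         three = two + 1#
         D = quartic 1# (- three) (- three) 1# 1#
     in ((λ n → V (2 * n))
           ≋ (cubic (V 0) (- (three · V 0) + V 2)
                    (- (two · V 0) + V 1 - two · V 2 + V 3)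
                    (- (two · V 2) + V 3) ⊘ D))
      × ((λ n → V (suc (2 * n)))
           ≋ (cubic (V 1) (- (three · V 1) + V 3)
                    (V 0 - V 1 + two · V 2 - V 3)
                    (V 0 + V 1 + V 2 - V 3) ⊘ D))
mainTheorem8 R c0 c1 c2 c3 _ =
    tetra-everyOther-⊘ c0 c1 c2 c3 0 (tetra-even-numerator c0 c1 c2 c3)
  , tetra-everyOther-⊘ c0 c1 c2 c3 1 (tetra-odd-numerator c0 c1 c2 c3)
  where open PowerSeries R
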